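{- Let $\mathsf{L}$ be a description logic, $\mathcal{T}$ a TBox and $C\in\mathsf{L}$. Then $C$ is satisfiable with respect to $\mathcal{T}$ if and only if $C$ has a witness that is admissible with respect to $\mathcal{T}$.
   Context: A description logic (DL) $\mathsf{L}$ is based on infinite sets $\mathsf{NC}$ of atomic concepts and $\mathsf{NR}$ of atomic roles; $\mathsf{L}$ is identified with its set of well-formed concepts, which is closed under boolean operations ($\sqcap,\sqcup,\neg$) and sub-concepts. An interpretation is a pair $\mathcal{I}=(\Delta^{\mathcal{I}},\cdot^{\mathcal{I}})$ with $\Delta^{\mathcal{I}}$ non-empty and $\cdot^{\mathcal{I}}$ mapping $\mathsf{NC}$ to $2^{\Delta^{\mathcal{I}}}$ and $\mathsf{NR}$ to $2^{\Delta^{\mathcal{I}}\times\Delta^{\mathcal{I}}}$. With $\mathsf{L}$ is associated a set $\mathsf{Int}(\mathsf{L})$ of admissible interpretations, closed under isomorphism, such that for any two interpretations agreeing on $\mathsf{NR}$, one is in $\mathsf{Int}(\mathsf{L})$ iff the other is. Every $\mathcal{I}\in\mathsf{Int}(\mathsf{L})$ extends to all concepts so that (I1) boolean combinations are interpreted as the corresponding set-theoretic boolean combinations, and (I2) $C^{\mathcal{I}}$ depends only on the interpretations of the atomic concepts and roles occurring syntactically in $C$. A TBox $\mathcal{T}$ is a finite set of axioms $C_1\sqsubseteq C_2$ or $C_1\doteq C_2$ with $C_i\in\mathsf{L}$; $\mathcal{I}\in\mathsf{Int}(\mathsf{L})$ is a model of $\mathcal{T}$ ($\mathcal{I}\models\mathcal{T}$)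 iff $C_1^{\mathcal{I}}\subseteq C_2^{\mathcal{I}}$ (resp. $=$) for each axiom. $C$ is satisfiable w.r.t. $\mathcal{T}$ iff some $\mathcal{I}\in\mathsf{Int}(\mathsf{L})$ has $\mathcal{I}\models\mathcal{T}$ and $C^{\mathcal{I}}\neq\emptyset$. A witness for $C$ is a triple $\mathcal{W}=(\Delta^{\mathcal{W}},\cdot^{\mathcal{W}},\mathcal{L}^{\mathcal{W}})$ with $\Delta^{\mathcal{W}}$ non-empty, $\cdot^{\mathcal{W}}$ mapping $\mathsf{NR}$ to $2^{\Delta^{\mathcal{W}}\times\Delta^{\mathcal{W}}}$, and $\mathcal{L}^{\mathcal{W}}:\Delta^{\mathcal{W}}\to2^{\mathsf{L}}$, such that (W1) some $x$ has $C\in\mathcal{L}^{\mathcal{W}}(x)$; (W2) some $\mathcal{I}\in\mathsf{Int}(\mathsf{L})$ stems from $\mathcal{W}$; (W3) every $\mathcal{I}\in\mathsf{Int}(\mathsf{L})$ stemming from $\mathcal{W}$ satisfies $D\in\mathcal{L}^{\mathcal{W}}(x)\Rightarrow x\in D^{\mathcal{I}}$. $\mathcal{I}$ stems from $\mathcal{W}$ if $\Delta^{\mathcal{I}}=\Delta^{\mathcal{W}}$, $\cdot^{\mathcal{I}}|_{\mathsf{NR}}=\cdot^{\mathcal{W}}$, and for all $A\in\mathsf{NC}$: $A\in\mathcal{L}^{\mathcal{W}}(x)\Rightarrow x\in A^{\mathcal{I}}$ and $\neg A\in\mathcal{L}^{\mathcal{W}}(x)\Rightarrow x\notin A^{\mathcal{I}}$.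 $\mathcal{W}$ is admissible w.r.t. $\mathcal{T}$ if some $\mathcal{I}\in\mathsf{Int}(\mathsf{L})$ stemming from $\mathcal{W}$ satisfies $\mathcal{I}\models\mathcal{T}$. -}

module Defs where

open import Data.Nat using (ℕ)
open import Data.Bool using (Bool; true; false; _∧_; _∨_; not)
open import Data.Product using (Σ; _×_; _,_; ∃)
open import Data.Sum using (_⊎_)
open import Data.List using (List)
open import Data.List.Relation.Unary.All using (All)
open import Function.Bundles using (_↣_; _↔_; _⇔_; Inverse)
open import Relation.Binary.PropositionalEquality using (_≡_)

-- Subsets of a set X are represented classically by characteristic
-- functions X → Bool.

record Interp (NC NR : Set) (Δ : Set) : Set where
  field
    cn : NC → Δ → Bool
    rl : NR → Δ → Δ → Bool
open Interp public

record DL : Set₁ where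
  infixr 7 _⊓_
  infixr 6 _⊔_
  field
    NC NR    : Set
    NC-inf   : ℕ ↣ NC
    NR-inf   : ℕ ↣ NR
    Con      : Set
    atom     : NC → Con
    _⊓_ _⊔_  : Con → Con → Con
    ¬_       : Con → Con
    occC     : NC → Con → Set
    occR     : NR → Con → Set
    occC-atom : ∀ A → occC A (atom A)
    occC-⊓   : ∀ A C D → occC A (C ⊓ D) ⇔ (occC A C ⊎ occC A D)
    occC-⊔   : ∀ A C D → occC A (C ⊔ D) ⇔ (occC A C ⊎ occC A D)
    occC-¬   : ∀ A C → occC A (¬ C) ⇔ occC A C
    occR-⊓   : ∀ R C D → occR R (C ⊓ D) ⇔ (occR R C ⊎ occR R D)
    occR-⊔   : ∀ R C D → occR R (C ⊔ D) ⇔ (occR R C ⊎ occR R D)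
    occR-¬   : ∀ R C → occR R (¬ C) ⇔ occR R C
    Int      : {Δ : Set} → Interp NC NR Δ → Set
    Int-iso  : {Δ Δ' : Set} (I : Interp NC NR Δ) (J : Interp NC NR Δ')
               (f : Δ ↔ Δ') →
               (∀ A x → cn J A (Inverse.to f x) ≡ cn I A x) →
               (∀ R x y → rl J R (Inverse.to f x) (Inverse.to f y) ≡ rl I R x y) →
               Int I → Int J
    Int-NR   : {Δ : Set} (I J : Interp NC NR Δ) →
               (∀ R x y → rl I R x y ≡ rl J R x y) → Int I → Int J
    ext      : {Δ : Set} (I : Interp NC NR Δ) → Int I → Con → Δ → Bool
    ext-atom : {Δ : Set} (I : Interp NC NR Δ) (p : Int I) →
               ∀ A x → ext I p (atom A) x ≡ cn I A x
    ext-⊓    : {Δ : Set} (I : Interp NC NR Δ) (p : Int I) →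
               ∀ C D x → ext I p (C ⊓ D) x ≡ (ext I p C x ∧ ext I p D x)
    ext-⊔    : {Δ : Set} (I : Interp NC NR Δ) (p : Int I) →
               ∀ C D x → ext I p (C ⊔ D) x ≡ (ext I p C x ∨ ext I p D x)
    ext-¬    : {Δ : Set} (I : Interp NC NR Δ) (p : Int I) →
               ∀ C x → ext I p (¬ C) x ≡ not (ext I p C x)
    ext-loc  : {Δ : Set} (I J : Interp NC NR Δ) (p : Int I) (q : Int J) →
               ∀ C →
               (∀ A → occC A C → ∀ x → cn I A x ≡ cn J A x) →
               (∀ R → occR R C → ∀ x y → rl I R x y ≡ rl J R x y) →
               ∀ x → ext I p C x ≡ ext J q C x

module _ (L : DL) where
  open DL L

  data Axiom : Set where
    _⊑_ : Con → Con → Axiom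
    _≐_ : Con → Con → Axiom

  TBox : Set
  TBox = List Axiom

  _⊨ₐ_ : {Δ : Set} → (Σ (Interp NC NR Δ) Int) → Axiom → Set
  (I , p) ⊨ₐ (C ⊑ D) = ∀ x → ext I p C x ≡ true → ext I p D x ≡ true
  (I , p) ⊨ₐ (C ≐ D) = ∀ x → ext I p C x ≡ ext I p D x

  _⊨_ : {Δ : Set} → (Σ (Interp NC NR Δ) Int) → TBox → Set
  Ip ⊨ T = All (Ip ⊨ₐ_) T

  -- C satisfiable w.r.t. T  (non-emptiness of the domain follows from
  -- C^I ≠ ∅)
  Satisfiable : TBox → Con → Set₁
  Satisfiable T C =
    Σ Set λ Δ → Σ (Interp NC NR Δ) λ I → Σ (Int I) λ p →
      ((I , p) ⊨ T) × ∃ λ (x : Δ) → ext I p C x ≡ true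

  record PreWitness (Δ : Set) : Set where
    field
      wrl : NR → Δ → Δ → Bool
      lab : Δ → Con → Bool
  open PreWitness public

  StemsFrom : {Δ : Set} → Interp NC NR Δ → PreWitness Δ → Set
  StemsFrom I W =
    (∀ R x y → rl I R x y ≡ wrl W R x y) ×
    (∀ A x → lab W x (atom A) ≡ true → cn I A x ≡ true) ×
    (∀ A x → lab W x (¬ atom A) ≡ true → cn I A x ≡ false)

  -- W is a witness for C  (W1)-(W3); non-emptiness follows from (W1)
  IsWitness : {Δ : Set} → PreWitness Δ → Con → Set
  IsWitness {Δ} W C =
    (∃ λ (x : Δ) → lab W x C ≡ true) ×
    (Σ (Interp NC NR Δ) λ I → Int I × StemsFrom I W) ×
    (∀ (I : Interp NC NR Δ) (p : Int I) → StemsFrom I W →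
       ∀ D x → lab W x D ≡ true → ext I p D x ≡ true)

  Admissible : {Δ : Set} → PreWitness Δ → TBox → Set
  Admissible {Δ} W T =
    Σ (Interp NC NR Δ) λ I → Σ (Int I) λ p → StemsFrom I W × ((I , p) ⊨ T)

{-# OPTIONS --safe #-}
-- Every admissible interpretation I induces a canonical witness: keep the
-- roles of I and label each element with all concepts it satisfies in I.
-- An interpretation stemming from it has the roles of I and, because every
-- atom is labelled either positively or negatively, the atomic concepts of I
-- too; by locality (I2) it therefore interprets every concept as I does, which
-- is (W3). Conversely, an admissible interpretation stemming from a witness
-- for C satisfies C at the element labelled C, again by (W3).
module Submission where

open import Defs
open import Data.Bool using (true; false; not)
open import Data.Bool.Properties using (not-injective)
open import Data.Product using (Σ; _×_; _,_)
open import Function.Bundles using (_⇔_; mk⇔)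
open import Relation.Binary.PropositionalEquality using (_≡_; refl; sym; trans; cong; module ≡-Reasoning)
open ≡-Reasoning

module _ (L : DL) where
  open DL L

  module _ {Δ : Set} (I : Interp NC NR Δ) (p : Int I) where

    canonicalWitness : PreWitness L Δ
    canonicalWitness = record { wrl = rl I ; lab = λ x D → ext I p D x }

    stemsFrom-canonicalWitness : StemsFrom L I canonicalWitness
    stemsFrom-canonicalWitness = (λ _ _ _ → refl) , positive , negative
      where
      positive : ∀ A x → ext I p (atom A) x ≡ true → cn I A x ≡ true
      positive A x e = trans (sym (ext-atom I p A x)) e

      negative : ∀ A x → ext I p (¬ atom A) x ≡ true → cn I A x ≡ false
      negative A x e = not-injective (begin
        not (cn I A x)              ≡⟨ cong not (ext-atom I p A x) ⟨
        not (ext I p (atom A) x)    ≡⟨ ext-¬ I p (atom A) x ⟨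
        ext I p (¬ atom A) x        ≡⟨ e ⟩
        true                        ∎)

    stemsFrom-canonicalWitness⇒cn-agree : ∀ J → StemsFrom L J canonicalWitness →
                                          ∀ A x → cn I A x ≡ cn J A x
    stemsFrom-canonicalWitness⇒cn-agree J (_ , positive , negative) A x
      with cn I A x in eq
    ... | true  = sym (positive A x (trans (ext-atom I p A x) eq))
    ... | false = sym (negative A x (begin
      ext I p (¬ atom A) x        ≡⟨ ext-¬ I p (atom A) x ⟩
      not (ext I p (atom A) x)    ≡⟨ cong not (trans (ext-atom I p A x) eq) ⟩
      true                        ∎))

    stemsFrom-canonicalWitness⇒ext-agree : ∀ J (q : Int J) → StemsFrom L J canonicalWitness →
                                           ∀ D x → ext I p D x ≡ ext J q D x
    stemsFrom-canonicalWitness⇒ext-agree J q s@(same-roles , _) D =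
      ext-loc I J p q D (λ A _ → stemsFrom-canonicalWitness⇒cn-agree J s A)
                        (λ R _ x y → sym (same-roles R x y))

    canonicalWitness-isWitness : ∀ {C} x → ext I p C x ≡ true → IsWitness L canonicalWitness C
    canonicalWitness-isWitness x Cx =
      (x , Cx) ,
      (I , p , stemsFrom-canonicalWitness) ,
      λ J q s D y Dy → trans (sym (stemsFrom-canonicalWitness⇒ext-agree J q s D y)) Dy

    canonicalWitness-admissible : ∀ {T} → _⊨_ L (I , p) T → Admissible L canonicalWitness T
    canonicalWitness-admissible I⊨T = I , p , stemsFrom-canonicalWitness , I⊨T

  AdmissibleWitness : TBox L → Con → Set₁
  AdmissibleWitness T C =
    Σ Set λ Δ → Σ (PreWitness L Δ) λ W → IsWitness L W C × Admissible L W T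

  satisfiable⇒admissibleWitness : ∀ {T C} → Satisfiable L T C → AdmissibleWitness T C
  satisfiable⇒admissibleWitness (Δ , I , p , I⊨T , x , Cx) =
    Δ , canonicalWitness I p ,
    canonicalWitness-isWitness I p x Cx , canonicalWitness-admissible I p I⊨T

  admissibleWitness⇒satisfiable : ∀ {T C} → AdmissibleWitness T C → Satisfiable L T C
  admissibleWitness⇒satisfiable {C = C} (Δ , W , ((x , Cx) , _ , sound) , (I , p , s , I⊨T)) =
    Δ , I , p , I⊨T , x , sound I p s C x Cx

mainTheorem2 : (L : DL) (T : TBox L) (C : DL.Con L) →
    Satisfiable L T C ⇔
      (Σ Set λ Δ → Σ (PreWitness L Δ) λ W → IsWitness L W C × Admissible L W T)
mainTheorem2 L T C = mk⇔ (satisfiable⇒admissibleWitness L) (admissibleWitness⇒satisfiable L)
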